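{- Let $r\ge 2$ and let $G$ be a graph on $n$ vertices with $\Delta(G)\le r$ such that for every $t\ge 3$, \[ k_t(G)\le\frac{r-t+1}{t}\,k_{t-1}(G). \] Then \[ k(G)\le 1+\frac{n}{r-1}\,(2^r-2). \]
   Context: Graphs are finite and simple. A clique is a set of pairwise adjacent vertices; $k_t(G)$ is the number of cliques of size $t$ in $G$ and $k(G)=\sum_{t\ge0}k_t(G)$ (so the empty clique is counted). -}

module Defs where

open import Data.Nat using (ℕ; zero; suc)
open import Data.Bool using (Bool; true; false; _∧_; _∨_; not)
open import Data.Fin using (Fin; _≟_)
open import Data.Fin.Subset using (Subset)
open import Data.Vec using (Vec; []; _∷_; lookup)
open import Data.List using (List; []; _∷_; _++_; map; length; filterᵇ; allFin; foldr)
open import Relation.Nullary.Decidable using (⌊_⌋)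
open import Relation.Binary.PropositionalEquality using (_≡_)

record Graph (n : ℕ) : Set where
  field
    adj    : Fin n → Fin n → Bool
    sym    : ∀ i j → adj i j ≡ adj j i
    irrefl : ∀ i → adj i i ≡ false
open Graph public

allSubsets : (n : ℕ) → List (Subset n)
allSubsets zero    = [] ∷ []
allSubsets (suc n) = map (true ∷_) (allSubsets n) ++ map (false ∷_) (allSubsets n)

allᵇ : {A : Set} → (A → Bool) → List A → Bool
allᵇ p = foldr (λ x b → p x ∧ b) true

size : ∀ {n} → Subset n → ℕ
size S = length (filterᵇ (lookup S) (allFin _))

isCliqueᵇ : ∀ {n} → Graph n → Subset n → Bool
isCliqueᵇ {n} G S =
  allᵇ (λ i → allᵇ (λ j → not (lookup S i ∧ lookup S j ∧ not ⌊ i ≟ j ⌋) ∨ adj G i j)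
                 (allFin n))
      (allFin n)

cliques : ∀ {n} → Graph n → List (Subset n)
cliques {n} G = filterᵇ (isCliqueᵇ G) (allSubsets n)

kₜ : ∀ {n} → ℕ → Graph n → ℕ
kₜ t G = length (filterᵇ (λ S → ⌊ Data.Nat._≟_ (size S) t ⌋) (cliques G))

-- k(G): total number of cliques (empty clique counted).
k : ∀ {n} → Graph n → ℕ
k G = length (cliques G)

degree : ∀ {n} → Graph n → Fin n → ℕ
degree {n} G i = length (filterᵇ (adj G i) (allFin n))

MaxDegree≤ : ∀ {n} → Graph n → ℕ → Set
MaxDegree≤ G r = ∀ i → degree G i Data.Nat.≤ r

-- Write a_t = k_t(G). Trivially a_0 ≤ 1 and a_1 ≤ n, and the handshake lemma gives
-- 2 a_2 ≤ Σ deg ≤ n r. Since t C(r,t) = (r - t + 1) C(r,t-1), the hypothesis carries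
-- (r - 1) a_2 ≤ n C(r,2) over to (r - 1) a_t ≤ n C(r,t) for every t ≥ 2, and summing over t,
-- (r - 1) k(G) ≤ (r - 1) + (r - 1) n + n (2^r - 1 - r) = (r - 1) + n (2^r - 2).
module Submission where

open import Defs hiding (sym)
import Algebra.Properties.CommutativeMonoid.Sum as Sum
import Algebra.Properties.CommutativeSemigroup as CommutativeSemigroupProperties
open import Data.Bool using (Bool; true; false; _∧_; _∨_; not)
open import Data.Fin using (Fin; zero; suc; _≟_)
import Data.Fin.Properties as Fin
open import Data.Fin.Subset using (Subset)
open import Data.Integer using (+_; _-_; _⊖_; -_) renaming (_≤_ to _≤ℤ_; _*_ to _*ℤ_; _+_ to _+ℤ_)
import Data.Integer.Properties as ℤ
open import Data.List using (List; []; _∷_; _++_; map; length; filterᵇ; allFin; tabulate)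
open import Data.List.Membership.Propositional using (_∈_)
open import Data.List.Membership.Propositional.Properties using (∈-allFin)
open import Data.List.Properties using (length-tabulate; map-tabulate; length-++; length-filter; filter-++)
open import Data.List.Relation.Unary.Any using (here; there)
open import Data.Nat as ℕ using (ℕ; zero; suc; _≤_; _+_; _*_; _∸_; _^_; z≤n; s≤s)
open import Data.Nat.Combinatorics using (_C_; nC1≡n; nCk+nC[k+1]≡[n+1]C[k+1])
open import Data.Nat.Properties hiding (_≟_)
open import Data.Nat.Tactic.RingSolver using (solve-∀)
open import Data.Product using (_×_; _,_; proj₁; proj₂)
open import Data.Sum using (inj₁; inj₂)
open import Data.Vec using ([]; _∷_; lookup)
open import Function using (_∘_; id)
open import Relation.Binary.PropositionalEquality
open import Relation.Nullary using (yes; no; ¬_; contradiction)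
open import Relation.Nullary.Decidable using (⌊_⌋; T?)

private
  variable
    A B : Set
    n : ℕ

open Sum +-0-commutativeMonoid using (sum-syntax; ∑-distrib-+; sum-cong-≗)
open CommutativeSemigroupProperties *-commutativeSemigroup using (x∙yz≈y∙xz)

indicator : Bool → ℕ
indicator true  = 1
indicator false = 0

count : (A → Bool) → List A → ℕ
count p xs = length (filterᵇ p xs)

count-∷ : (p : A → Bool) (x : A) (xs : List A) → count p (x ∷ xs) ≡ indicator (p x) + count p xs
count-∷ p x xs with p x
... | true  = refl
... | false = refl

count-++ : (p : A → Bool) (xs ys : List A) → count p (xs ++ ys) ≡ count p xs + count p ys
count-++ p xs ys = trans (cong length (filter-++ (T? ∘ p) xs ys)) (length-++ (filterᵇ p xs))

count-map : (p : B → Bool) (f : A → B) (xs : List A) → count p (map f xs) ≡ count (p ∘ f) xs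
count-map p f []       = refl
count-map p f (x ∷ xs) with p (f x)
... | true  = cong suc (count-map p f xs)
... | false = count-map p f xs

count-filterᵇ : (p q : A → Bool) (xs : List A) → count p (filterᵇ q xs) ≡ count (λ x → q x ∧ p x) xs
count-filterᵇ p q []       = refl
count-filterᵇ p q (x ∷ xs) with q x
... | false = count-filterᵇ p q xs
... | true with p x
...   | true  = cong suc (count-filterᵇ p q xs)
...   | false = count-filterᵇ p q xs

count-none : (p : A → Bool) → (∀ x → ¬ p x ≡ true) → (xs : List A) → count p xs ≡ 0
count-none p none []       = refl
count-none p none (x ∷ xs) with p x in px
... | true  = contradiction px (none x)
... | false = count-none p none xs

count≤length : (p : A → Bool) (xs : List A) → count p xs ≤ length xs
count≤length p = length-filter (T? ∘ p)

allᵇ-sound : (p : A → Bool) {xs : List A} → allᵇ p xs ≡ true → ∀ {x} → x ∈ xs → p x ≡ true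
allᵇ-sound p {y ∷ _} all-p x∈ with p y in py | all-p | x∈
... | true | all-p′ | here refl = py
... | true | all-p′ | there x∈′ = allᵇ-sound p all-p′ x∈′

count-allFin-suc : (p : Fin (suc n) → Bool) →
  count p (allFin (suc n)) ≡ indicator (p zero) + count (p ∘ suc) (allFin n)
count-allFin-suc {n} p = begin
  count p (zero ∷ tabulate suc)         ≡⟨ count-∷ p zero _ ⟩
  indicator (p zero) + count p (tabulate suc)
    ≡⟨ cong (λ xs → indicator (p zero) + count p xs) (map-tabulate id suc) ⟨
  indicator (p zero) + count p (map suc (allFin n)) ≡⟨ cong (_+_ (indicator (p zero))) (count-map p suc (allFin n)) ⟩
  indicator (p zero) + count (p ∘ suc) (allFin n)  ∎
  where open ≡-Reasoning

∑-indicator : (q : Fin n → Bool) → ∑[ i < n ] indicator (q i) ≡ count q (allFin n)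
∑-indicator {zero}  q = refl
∑-indicator {suc n} q = trans (cong (_+_ (indicator (q zero))) (∑-indicator (q ∘ suc))) (sym (count-allFin-suc q))

∑-bounded : (f : Fin n → ℕ) (r : ℕ) → (∀ i → f i ≤ r) → ∑[ i < n ] f i ≤ n * r
∑-bounded {zero}  f r f≤r = z≤n
∑-bounded {suc n} f r f≤r = +-mono-≤ (f≤r zero) (∑-bounded (f ∘ suc) r (f≤r ∘ suc))

size-∷ : (b : Bool) (S : Subset n) → size (b ∷ S) ≡ indicator b + size S
size-∷ b S = count-allFin-suc (lookup (b ∷ S))

size≤ : (S : Subset n) → size S ≤ n
size≤ {n} S = ≤-trans (count≤length (lookup S) (allFin n)) (≤-reflexive (length-tabulate id))

count-allSubsets-suc : (p : Subset (suc n) → Bool) →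
  count p (allSubsets (suc n)) ≡ count (p ∘ (true ∷_)) (allSubsets n) + count (p ∘ (false ∷_)) (allSubsets n)
count-allSubsets-suc {n} p =
  trans (count-++ p (map (true ∷_) (allSubsets n)) (map (false ∷_) (allSubsets n)))
        (cong₂ _+_ (count-map p (true ∷_) (allSubsets n)) (count-map p (false ∷_) (allSubsets n)))

Clique : (Fin n → Fin n → Bool) → Subset n → Set
Clique adj S = ∀ i j → lookup S i ≡ true → lookup S j ≡ true → ¬ i ≡ j → adj i j ≡ true

isCliqueᵇ-sound : (G : Graph n) (S : Subset n) → isCliqueᵇ G S ≡ true → Clique (adj G) S
isCliqueᵇ-sound {n} G S clique i j i∈S j∈S i≢j =
  entry (allᵇ-sound _ (allᵇ-sound _ clique (∈-allFin i)) (∈-allFin j))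
  where
  entry : not (lookup S i ∧ lookup S j ∧ not ⌊ i ≟ j ⌋) ∨ adj G i j ≡ true → adj G i j ≡ true
  entry e rewrite i∈S | j∈S with i ≟ j
  ... | yes i≡j = contradiction i≡j i≢j
  ... | no _    = e

count-size≡0≤1 : (p : Subset n → Bool) → (∀ S → p S ≡ true → size S ≡ 0) → count p (allSubsets n) ≤ 1
count-size≡0≤1 {zero} p empty with p []
... | true  = ≤-refl
... | false = z≤n
count-size≡0≤1 {suc n} p empty = begin
  count p (allSubsets (suc n))                           ≡⟨ count-allSubsets-suc p ⟩
  count (p ∘ (true ∷_)) (allSubsets n) + count (p ∘ (false ∷_)) (allSubsets n)
    ≡⟨ cong (_+ count (p ∘ (false ∷_)) (allSubsets n))
         (count-none (p ∘ (true ∷_)) (λ S pS → 1+n≢0 (trans (sym (size-∷ true S)) (empty _ pS)))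
                     (allSubsets n)) ⟩
  count (p ∘ (false ∷_)) (allSubsets n)
    ≤⟨ count-size≡0≤1 (p ∘ (false ∷_)) (λ S pS → trans (sym (size-∷ false S)) (empty _ pS)) ⟩
  1                                                      ∎
  where open ≤-Reasoning

count-singletons≤ : (p : Subset n → Bool) (q : Fin n → Bool) →
  (∀ S → p S ≡ true → size S ≡ 1 × (∀ j → lookup S j ≡ true → q j ≡ true)) →
  count p (allSubsets n) ≤ count q (allFin n)
count-singletons≤ {zero} p q singleton with p [] in p[]
... | true  = contradiction (proj₁ (singleton [] p[])) λ ()
... | false = z≤n
count-singletons≤ {suc n} p q singleton = begin
  count p (allSubsets (suc n))                           ≡⟨ count-allSubsets-suc p ⟩
  count (p ∘ (true ∷_)) (allSubsets n) + count (p ∘ (false ∷_)) (allSubsets n)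
    ≤⟨ +-mono-≤ containing-zero (count-singletons≤ (p ∘ (false ∷_)) (q ∘ suc) avoiding-zero) ⟩
  indicator (q zero) + count (q ∘ suc) (allFin n)        ≡⟨ count-allFin-suc q ⟨
  count q (allFin (suc n))                               ∎
  where
  open ≤-Reasoning
  avoiding-zero : ∀ S → p (false ∷ S) ≡ true → size S ≡ 1 × (∀ j → lookup S j ≡ true → q (suc j) ≡ true)
  avoiding-zero S pS = trans (sym (size-∷ false S)) (proj₁ (singleton _ pS))
                     , λ j → proj₂ (singleton _ pS) (suc j)
  containing-zero : count (p ∘ (true ∷_)) (allSubsets n) ≤ indicator (q zero)
  containing-zero with q zero in q0
  ... | true  = count-size≡0≤1 (p ∘ (true ∷_))
                  (λ S pS → suc-injective (trans (sym (size-∷ true S)) (proj₁ (singleton _ pS))))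
  ... | false = ≤-reflexive (count-none (p ∘ (true ∷_)) (λ S pS → zero∉q (proj₂ (singleton _ pS) zero refl))
                                        (allSubsets n))
    where
    zero∉q : ¬ q zero ≡ true
    zero∉q q0≡true = contradiction (trans (sym q0) q0≡true) λ ()

degreeSum : (Fin n → Fin n → Bool) → ℕ
degreeSum {n} adj = ∑[ i < n ] count (adj i) (allFin n)

degreeSum-suc : (adj : Fin (suc n) → Fin (suc n) → Bool) → (∀ i j → adj i j ≡ adj j i) →
  degreeSum adj ≡ indicator (adj zero zero) + 2 * count (adj zero ∘ suc) (allFin n)
                  + degreeSum (λ i j → adj (suc i) (suc j))
degreeSum-suc {n} adj adj-sym = begin
  count (adj zero) (allFin (suc n)) + ∑[ i < n ] count (adj (suc i)) (allFin (suc n))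
    ≡⟨ cong₂ _+_ (count-allFin-suc (adj zero)) (sum-cong-≗ (count-allFin-suc ∘ adj ∘ suc)) ⟩
  a₀₀ + d + ∑[ i < n ] (indicator (adj (suc i) zero) + count (adj (suc i) ∘ suc) (allFin n))
    ≡⟨ cong (_+_ (a₀₀ + d)) (∑-distrib-+ (indicator ∘ (λ i → adj (suc i) zero)) _) ⟩
  a₀₀ + d + (∑[ i < n ] indicator (adj (suc i) zero) + degreeSum adj′)
    ≡⟨ cong (λ m → a₀₀ + d + (m + degreeSum adj′)) (sum-cong-≗ (λ i → cong indicator (adj-sym (suc i) zero))) ⟩
  a₀₀ + d + (∑[ i < n ] indicator (adj zero (suc i)) + degreeSum adj′)
    ≡⟨ cong (λ m → a₀₀ + d + (m + degreeSum adj′)) (∑-indicator (adj zero ∘ suc)) ⟩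
  a₀₀ + d + (d + degreeSum adj′)
    ≡⟨ regroup a₀₀ d (degreeSum adj′) ⟩
  a₀₀ + 2 * d + degreeSum adj′ ∎
  where
  open ≡-Reasoning
  a₀₀ = indicator (adj zero zero)
  d = count (adj zero ∘ suc) (allFin n)
  adj′ = λ i j → adj (suc i) (suc j)
  regroup : ∀ a d s → a + d + (d + s) ≡ a + 2 * d + s
  regroup = solve-∀

handshake≤ : (adj : Fin n → Fin n → Bool) → (∀ i j → adj i j ≡ adj j i) → (p : Subset n → Bool) →
  (∀ S → p S ≡ true → size S ≡ 2 × Clique adj S) → 2 * count p (allSubsets n) ≤ degreeSum adj
handshake≤ {zero} adj adj-sym p edge with p [] in p[]
... | true  = contradiction (proj₁ (edge [] p[])) λ ()
... | false = z≤n
handshake≤ {suc n} adj adj-sym p edge = begin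
  2 * count p (allSubsets (suc n))                       ≡⟨ cong (2 *_) (count-allSubsets-suc p) ⟩
  2 * (count (p ∘ (true ∷_)) (allSubsets n) + count (p ∘ (false ∷_)) (allSubsets n))
    ≡⟨ *-distribˡ-+ 2 (count (p ∘ (true ∷_)) (allSubsets n)) _ ⟩
  2 * count (p ∘ (true ∷_)) (allSubsets n) + 2 * count (p ∘ (false ∷_)) (allSubsets n)
    ≤⟨ +-mono-≤ (*-monoʳ-≤ 2 (count-singletons≤ (p ∘ (true ∷_)) (adj zero ∘ suc) containing-zero))
                (handshake≤ (λ i j → adj (suc i) (suc j)) (λ i j → adj-sym (suc i) (suc j))
                            (p ∘ (false ∷_)) avoiding-zero) ⟩
  2 * count (adj zero ∘ suc) (allFin n) + degreeSum (λ i j → adj (suc i) (suc j))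
    ≤⟨ +-monoˡ-≤ _ (m≤n+m _ (indicator (adj zero zero))) ⟩
  indicator (adj zero zero) + 2 * count (adj zero ∘ suc) (allFin n) + degreeSum (λ i j → adj (suc i) (suc j))
    ≡⟨ degreeSum-suc adj adj-sym ⟨
  degreeSum adj                                          ∎
  where
  open ≤-Reasoning
  containing-zero : ∀ S → p (true ∷ S) ≡ true →
                    size S ≡ 1 × (∀ j → lookup S j ≡ true → adj zero (suc j) ≡ true)
  containing-zero S pS = suc-injective (trans (sym (size-∷ true S)) (proj₁ (edge _ pS)))
                       , λ j j∈S → proj₂ (edge _ pS) zero (suc j) refl j∈S λ ()
  avoiding-zero : ∀ S → p (false ∷ S) ≡ true → size S ≡ 2 × Clique (λ i j → adj (suc i) (suc j)) S
  avoiding-zero S pS = trans (sym (size-∷ false S)) (proj₁ (edge _ pS))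
                     , λ i j i∈S j∈S i≢j → proj₂ (edge _ pS) (suc i) (suc j) i∈S j∈S (i≢j ∘ Fin.suc-injective)

kₜ≡count : (G : Graph n) (t : ℕ) → kₜ t G ≡ count (λ S → isCliqueᵇ G S ∧ ⌊ size S ℕ.≟ t ⌋) (allSubsets n)
kₜ≡count {n} G t = count-filterᵇ (λ S → ⌊ size S ℕ.≟ t ⌋) (isCliqueᵇ G) (allSubsets n)

clique-of-size : (G : Graph n) (t : ℕ) (S : Subset n) →
  isCliqueᵇ G S ∧ ⌊ size S ℕ.≟ t ⌋ ≡ true → size S ≡ t × Clique (adj G) S
clique-of-size G t S h with isCliqueᵇ G S in clique | size S ℕ.≟ t | h
... | true | yes size≡t | _ = size≡t , isCliqueᵇ-sound G S clique

k₀≤1 : (G : Graph n) → kₜ 0 G ≤ 1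
k₀≤1 G = subst (_≤ 1) (sym (kₜ≡count G 0)) (count-size≡0≤1 _ (λ S → proj₁ ∘ clique-of-size G 0 S))

k₁≤n : (G : Graph n) → kₜ 1 G ≤ n
k₁≤n {n} G = begin
  kₜ 1 G                                      ≡⟨ kₜ≡count G 1 ⟩
  count (λ S → isCliqueᵇ G S ∧ ⌊ size S ℕ.≟ 1 ⌋) (allSubsets n)
    ≤⟨ count-singletons≤ _ (λ _ → true) (λ S h → proj₁ (clique-of-size G 1 S h) , λ _ _ → refl) ⟩
  count (λ _ → true) (allFin n)               ≤⟨ count≤length _ (allFin n) ⟩
  length (allFin n)                           ≡⟨ length-tabulate id ⟩
  n                                           ∎
  where open ≤-Reasoning

2*k₂≤n*Δ : (G : Graph n) (r : ℕ) → MaxDegree≤ G r → 2 * kₜ 2 G ≤ n * r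
2*k₂≤n*Δ {n} G r Δ≤r = begin
  2 * kₜ 2 G                                  ≡⟨ cong (2 *_) (kₜ≡count G 2) ⟩
  2 * count (λ S → isCliqueᵇ G S ∧ ⌊ size S ℕ.≟ 2 ⌋) (allSubsets n)
    ≤⟨ handshake≤ (adj G) (Graph.sym G) _ (clique-of-size G 2) ⟩
  degreeSum (adj G)                           ≤⟨ ∑-bounded (degree G) r Δ≤r ⟩
  n * r                                       ∎
  where open ≤-Reasoning

⊖≤∸ : ∀ m n → m ⊖ n ≤ℤ + (m ∸ n)
⊖≤∸ m n with n ℕ.≤? m
... | yes n≤m = ℤ.≤-reflexive (ℤ.⊖-≥ n≤m)
... | no  n≰m = subst (_≤ℤ + (m ∸ n)) (sym (ℤ.⊖-≰ n≰m)) ℤ.neg-≤-pos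

ratio-ℤ⇒ℕ : ∀ r t {a b} → (+ t) *ℤ (+ a) ≤ℤ ((+ r) - (+ t) +ℤ (+ 1)) *ℤ (+ b) → t * a ≤ (suc r ∸ t) * b
ratio-ℤ⇒ℕ r t {a} {b} h = ℤ.drop‿+≤+ (begin
  + (t * a)                        ≡⟨ ℤ.pos-* t a ⟩
  + t *ℤ + a                       ≤⟨ h ⟩
  (+ r - + t +ℤ + 1) *ℤ + b        ≡⟨ cong (_*ℤ + b) r-t+1≡ ⟩
  (suc r ⊖ t) *ℤ + b               ≤⟨ ℤ.*-monoʳ-≤-nonNeg (+ b) (⊖≤∸ (suc r) t) ⟩
  + (suc r ∸ t) *ℤ + b             ≡⟨ ℤ.pos-* (suc r ∸ t) b ⟨
  + ((suc r ∸ t) * b)              ∎)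
  where
  open ℤ.≤-Reasoning
  r-t+1≡ : + r - + t +ℤ + 1 ≡ suc r ⊖ t
  r-t+1≡ = begin-equality
    + r - + t +ℤ + 1               ≡⟨ ℤ.+-comm (+ r - + t) (+ 1) ⟩
    + 1 +ℤ (+ r - + t)             ≡⟨ ℤ.+-assoc (+ 1) (+ r) (- + t) ⟨
    + suc r - + t                  ≡⟨ ℤ.m-n≡m⊖n (suc r) t ⟩
    suc r ⊖ t                      ∎

absorption : ∀ r t → suc t * (r C suc t) + t * (r C t) ≡ r * (r C t)
absorption zero    zero    = refl
absorption zero    (suc t) = cong₂ _+_ (*-zeroʳ (2 + t)) (*-zeroʳ (suc t))
absorption (suc r) zero    =
  trans (+-identityʳ _) (trans (*-identityˡ _) (trans (nC1≡n (suc r)) (sym (*-identityʳ (suc r)))))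
absorption (suc r) (suc t) = begin
  (2 + t) * (suc r C (2 + t)) + suc t * (suc r C suc t)
    ≡⟨ cong₂ (λ u v → (2 + t) * u + suc t * v)
             (nCk+nC[k+1]≡[n+1]C[k+1] r (suc t)) (nCk+nC[k+1]≡[n+1]C[k+1] r t) ⟨
  (2 + t) * (y + z) + suc t * (x + y)             ≡⟨ regroup t x y z ⟩
  ((2 + t) * z + suc t * y) + (suc t * y + t * x) + y + x
    ≡⟨ cong₂ (λ u v → u + v + y + x) (absorption r (suc t)) (absorption r t) ⟩
  r * y + r * x + y + x                           ≡⟨ collect r x y ⟩
  suc r * (x + y)                                 ≡⟨ cong (suc r *_) (nCk+nC[k+1]≡[n+1]C[k+1] r t) ⟩
  suc r * (suc r C suc t)                         ∎
  where
  open ≡-Reasoning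
  x = r C t
  y = r C suc t
  z = r C (2 + t)
  regroup : ∀ t x y z → (2 + t) * (y + z) + suc t * (x + y) ≡ ((2 + t) * z + suc t * y) + (suc t * y + t * x) + y + x
  regroup = solve-∀
  collect : ∀ r x y → r * y + r * x + y + x ≡ suc r * (x + y)
  collect = solve-∀

absorption-∸ : ∀ r t → (r ∸ t) * (r C t) ≡ suc t * (r C suc t)
absorption-∸ r t = begin
  (r ∸ t) * (r C t)                                  ≡⟨ *-distribʳ-∸ (r C t) r t ⟩
  r * (r C t) ∸ t * (r C t)                        ≡⟨ cong (_∸ t * (r C t)) (absorption r t) ⟨
  suc t * (r C suc t) + t * (r C t) ∸ t * (r C t)  ≡⟨ m+n∸n≡m (suc t * (r C suc t)) (t * (r C t)) ⟩
  suc t * (r C suc t)                                ∎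
  where open ≡-Reasoning

sumUpTo : (ℕ → ℕ) → ℕ → ℕ
sumUpTo f zero    = f 0
sumUpTo f (suc m) = sumUpTo f m + f (suc m)

sumUpTo-+ : (f g : ℕ → ℕ) (m : ℕ) → sumUpTo (λ t → f t + g t) m ≡ sumUpTo f m + sumUpTo g m
sumUpTo-+ f g zero    = refl
sumUpTo-+ f g (suc m) = trans (cong (_+ (f (suc m) + g (suc m))) (sumUpTo-+ f g m))
                              (interchange (sumUpTo f m) (sumUpTo g m) (f (suc m)) (g (suc m)))
  where
  interchange : ∀ a b c d → a + b + (c + d) ≡ a + c + (b + d)
  interchange = solve-∀

sumUpTo-cong : {f g : ℕ → ℕ} → (∀ t → f t ≡ g t) → ∀ m → sumUpTo f m ≡ sumUpTo g m
sumUpTo-cong f≗g zero    = f≗g 0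
sumUpTo-cong f≗g (suc m) = cong₂ _+_ (sumUpTo-cong f≗g m) (f≗g (suc m))

1≤sumUpTo-≟ : ∀ {v m} → v ≤ m → 1 ≤ sumUpTo (λ t → indicator ⌊ v ℕ.≟ t ⌋) m
1≤sumUpTo-≟ {m = zero}  z≤n = ≤-refl
1≤sumUpTo-≟ {m = suc m} v≤1+m with m≤n⇒m<n∨m≡n v≤1+m
... | inj₁ (s≤s v≤m) = ≤-trans (1≤sumUpTo-≟ v≤m) (m≤m+n _ _)
... | inj₂ refl rewrite ≟-diag {suc m} refl = m≤n+m 1 _

length≤sumUpTo-count-fibres : (f : A → ℕ) (m : ℕ) → (∀ x → f x ≤ m) → (xs : List A) →
  length xs ≤ sumUpTo (λ t → count (λ x → ⌊ f x ℕ.≟ t ⌋) xs) m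
length≤sumUpTo-count-fibres f m f≤m []       = z≤n
length≤sumUpTo-count-fibres f m f≤m (x ∷ xs) = begin
  1 + length xs
    ≤⟨ +-mono-≤ (1≤sumUpTo-≟ (f≤m x)) (length≤sumUpTo-count-fibres f m f≤m xs) ⟩
  sumUpTo (λ t → indicator ⌊ f x ℕ.≟ t ⌋) m + sumUpTo (λ t → count (λ y → ⌊ f y ℕ.≟ t ⌋) xs) m
    ≡⟨ sumUpTo-+ (λ t → indicator ⌊ f x ℕ.≟ t ⌋) _ m ⟨
  sumUpTo (λ t → indicator ⌊ f x ℕ.≟ t ⌋ + count (λ y → ⌊ f y ℕ.≟ t ⌋) xs) m
    ≡⟨ sumUpTo-cong (λ t → count-∷ (λ y → ⌊ f y ℕ.≟ t ⌋) x xs) m ⟨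
  sumUpTo (λ t → count (λ y → ⌊ f y ℕ.≟ t ⌋) (x ∷ xs)) m ∎
  where open ≤-Reasoning

k≤sumUpTo-kₜ : (G : Graph n) → k G ≤ sumUpTo (λ t → kₜ t G) n
k≤sumUpTo-kₜ {n} G = length≤sumUpTo-count-fibres size n size≤ (cliques G)

sumUpTo-C-pascal : ∀ r m → sumUpTo (suc r C_) (suc m) ≡ sumUpTo (r C_) m + sumUpTo (r C_) (suc m)
sumUpTo-C-pascal r zero    = cong suc (sym (nCk+nC[k+1]≡[n+1]C[k+1] r 0))
sumUpTo-C-pascal r (suc m) = begin
  sumUpTo (suc r C_) (suc m) + suc r C (2 + m)
    ≡⟨ cong₂ _+_ (sumUpTo-C-pascal r m) (sym (nCk+nC[k+1]≡[n+1]C[k+1] r (suc m))) ⟩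
  (sumUpTo (r C_) m + (sumUpTo (r C_) m + r C suc m)) + (r C suc m + r C (2 + m))
    ≡⟨ regroup (sumUpTo (r C_) m) (r C suc m) (r C (2 + m)) ⟩
  (sumUpTo (r C_) m + r C suc m) + (sumUpTo (r C_) m + r C suc m + r C (2 + m)) ∎
  where
  open ≡-Reasoning
  regroup : ∀ a b c → (a + (a + b)) + (b + c) ≡ (a + b) + ((a + b) + c)
  regroup = solve-∀

sumUpTo-C≤2^ : ∀ r m → sumUpTo (r C_) m ≤ 2 ^ r
sumUpTo-C≤2^ zero    zero    = ≤-refl
sumUpTo-C≤2^ zero    (suc m) = ≤-trans (≤-reflexive (+-identityʳ _)) (sumUpTo-C≤2^ zero m)
sumUpTo-C≤2^ (suc r) zero    = m^n>0 2 (suc r)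
sumUpTo-C≤2^ (suc r) (suc m) = begin
  sumUpTo (suc r C_) (suc m)                      ≡⟨ sumUpTo-C-pascal r m ⟩
  sumUpTo (r C_) m + sumUpTo (r C_) (suc m)       ≤⟨ +-mono-≤ (sumUpTo-C≤2^ r m) (sumUpTo-C≤2^ r (suc m)) ⟩
  2 ^ r + 2 ^ r                                   ≡⟨ cong (_+_ (2 ^ r)) (+-identityʳ (2 ^ r)) ⟨
  2 ^ suc r                                       ∎
  where open ≤-Reasoning

-- a t plays the role of k_t(G), and suc c that of r.
module CliqueCountBound (c n : ℕ) (a : ℕ → ℕ) (a₀≤1 : a 0 ≤ 1) (a₁≤n : a 1 ≤ n)
  (2a₂≤n[1+c] : 2 * a 2 ≤ n * suc c)
  (ratio : ∀ t → 3 ≤ t → t * a t ≤ (suc (suc c) ∸ t) * a (t ∸ 1)) where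

  c*aₜ≤n*C : ∀ t → c * a (2 + t) ≤ n * (suc c C (2 + t))
  c*aₜ≤n*C zero = *-cancelˡ-≤ 2 (begin
    2 * (c * a 2)              ≡⟨ x∙yz≈y∙xz 2 c (a 2) ⟩
    c * (2 * a 2)              ≤⟨ *-monoʳ-≤ c 2a₂≤n[1+c] ⟩
    c * (n * suc c)            ≡⟨ x∙yz≈y∙xz c n (suc c) ⟩
    n * (c * suc c)            ≡⟨ cong (λ m → n * (c * m)) (nC1≡n (suc c)) ⟨
    n * (c * (suc c C 1))      ≡⟨ cong (n *_) (absorption-∸ (suc c) 1) ⟩
    n * (2 * (suc c C 2))      ≡⟨ x∙yz≈y∙xz n 2 _ ⟩
    2 * (n * (suc c C 2))      ∎)
    where open ≤-Reasoning
  c*aₜ≤n*C (suc t) = *-cancelˡ-≤ (3 + t) (begin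
    (3 + t) * (c * a (3 + t))                  ≡⟨ x∙yz≈y∙xz (3 + t) c _ ⟩
    c * ((3 + t) * a (3 + t))                  ≤⟨ *-monoʳ-≤ c (ratio (3 + t) (s≤s (s≤s (s≤s z≤n)))) ⟩
    c * ((suc c ∸ (2 + t)) * a (2 + t))        ≡⟨ x∙yz≈y∙xz c (suc c ∸ (2 + t)) _ ⟩
    (suc c ∸ (2 + t)) * (c * a (2 + t))        ≤⟨ *-monoʳ-≤ (suc c ∸ (2 + t)) (c*aₜ≤n*C t) ⟩
    (suc c ∸ (2 + t)) * (n * (suc c C (2 + t))) ≡⟨ x∙yz≈y∙xz (suc c ∸ (2 + t)) n _ ⟩
    n * ((suc c ∸ (2 + t)) * (suc c C (2 + t))) ≡⟨ cong (n *_) (absorption-∸ (suc c) (2 + t)) ⟩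
    n * ((3 + t) * (suc c C (3 + t)))          ≡⟨ x∙yz≈y∙xz n (3 + t) _ ⟩
    (3 + t) * (n * (suc c C (3 + t)))          ∎)
    where open ≤-Reasoning

  c*sumUpTo-a+2n≤ : ∀ m → c * sumUpTo a (suc m) + 2 * n ≤ c + n * sumUpTo (suc c C_) (suc m)
  c*sumUpTo-a+2n≤ zero = begin
    c * (a 0 + a 1) + 2 * n                    ≡⟨ cong (_+ 2 * n) (*-distribˡ-+ c (a 0) (a 1)) ⟩
    c * a 0 + c * a 1 + 2 * n                  ≤⟨ +-monoˡ-≤ (2 * n) (+-mono-≤ (*-monoʳ-≤ c a₀≤1) (*-monoʳ-≤ c a₁≤n)) ⟩
    c * 1 + c * n + 2 * n                      ≡⟨ regroup c n ⟩
    c + n * (1 + suc c)                        ≡⟨ cong (λ m → c + n * (1 + m)) (nC1≡n (suc c)) ⟨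
    c + n * (1 + suc c C 1)                    ∎
    where
    open ≤-Reasoning
    regroup : ∀ c n → c * 1 + c * n + 2 * n ≡ c + n * (1 + suc c)
    regroup = solve-∀
  c*sumUpTo-a+2n≤ (suc m) = begin
    c * (S + a (2 + m)) + 2 * n                 ≡⟨ regroup c S (a (2 + m)) (2 * n) ⟩
    (c * S + 2 * n) + c * a (2 + m)             ≤⟨ +-mono-≤ (c*sumUpTo-a+2n≤ m) (c*aₜ≤n*C m) ⟩
    (c + n * Σ) + n * (suc c C (2 + m))         ≡⟨ +-assoc c _ _ ⟩
    c + (n * Σ + n * (suc c C (2 + m)))         ≡⟨ cong (_+_ c) (*-distribˡ-+ n Σ _) ⟨
    c + n * (Σ + suc c C (2 + m))               ∎
    where
    open ≤-Reasoning
    S = sumUpTo a (suc m)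
    Σ = sumUpTo (suc c C_) (suc m)
    regroup : ∀ c S x y → c * (S + x) + y ≡ (c * S + y) + c * x
    regroup = solve-∀

  c*sumUpTo-a≤ : ∀ m → c * sumUpTo a m ≤ c + n * (2 ^ suc c ∸ 2)
  c*sumUpTo-a≤ zero    = ≤-trans (*-monoʳ-≤ c a₀≤1) (≤-trans (≤-reflexive (*-identityʳ c)) (m≤m+n c _))
  c*sumUpTo-a≤ (suc m) = +-cancelʳ-≤ (2 * n) _ _ (begin
    c * sumUpTo a (suc m) + 2 * n               ≤⟨ c*sumUpTo-a+2n≤ m ⟩
    c + n * sumUpTo (suc c C_) (suc m)          ≤⟨ +-monoʳ-≤ c (*-monoʳ-≤ n (sumUpTo-C≤2^ (suc c) (suc m))) ⟩
    c + n * 2 ^ suc c                           ≡⟨ cong (λ x → c + n * x) (m∸n+n≡m 2≤2^[1+c]) ⟨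
    c + n * (2 ^ suc c ∸ 2 + 2)                 ≡⟨ regroup c n (2 ^ suc c ∸ 2) ⟩
    c + n * (2 ^ suc c ∸ 2) + 2 * n             ∎)
    where
    open ≤-Reasoning
    2≤2^[1+c] : 2 ≤ 2 ^ suc c
    2≤2^[1+c] = *-monoʳ-≤ 2 (m^n>0 2 c)
    regroup : ∀ c n x → c + n * (x + 2) ≡ c + n * x + 2 * n
    regroup = solve-∀

lemma5p1 : (r n : ℕ) → 2 ≤ r → (G : Graph n) → MaxDegree≤ G r →
    (∀ t → 3 ≤ t → (+ t) *ℤ (+ (kₜ t G)) ≤ℤ ((+ r) - (+ t) +ℤ (+ 1)) *ℤ (+ (kₜ (t ∸ 1) G))) →
    (r ∸ 1) * k G ≤ (r ∸ 1) + n * (2 ^ r ∸ 2)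
lemma5p1 (suc c) n (s≤s _) G Δ≤r ratio =
  ≤-trans (*-monoʳ-≤ c (k≤sumUpTo-kₜ G)) (c*sumUpTo-a≤ n)
  where
  open CliqueCountBound c n (λ t → kₜ t G) (k₀≤1 G) (k₁≤n G) (2*k₂≤n*Δ G (suc c) Δ≤r)
                        (λ t 3≤t → ratio-ℤ⇒ℕ (suc c) t (ratio t 3≤t))
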